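{- Let $r\ge1$, let $F$ be a function and $(A_n)_{n\ge0}$ a sequence with $F(x)=\sum_{n\ge0}A_nx^n$. Then $F(0)=1$ and $F$ satisfies $$\Big(1+\sum_{i=1}^r(-x)^i\big(d^{i-1}e_{i-1}(u_1,\dots,u_{r-1})+d^ie_i(u_1,\dots,u_{r-1})\big)\Big)F(x)=F(xq)+\sum_{i=1}^r\sum_{\ell=1}^r\sum_{k=0}^{\min(i-1,\ell-1)}c_{k,i}b_{\ell-k,i}(-1)^{\ell-1}x^\ell F(xq^i)$$ if and only if $A_0=1$ and for all $n\ge1$ (with $A_j=0$ for $j<0$) $$(1-q^n)A_n=\sum_{m=1}^r\Big(d^{m-1}e_{m-1}(u_1,\dots,u_{r-1})+d^me_m(u_1,\dots,u_{r-1})+\sum_{i=1}^r\sum_{k=0}^{\min(i-1,m-1)}c_{k,i}b_{m-k,i}q^{i(n-m)}\Big)(-1)^{m+1}A_{n-m}.$$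
   Context: $c_{k,i}:=d^ku_r^kq^{k(k+1)/2}{i-1\brack k}_q$ and $b_{m,i}:=\big(d^{m-1}e_{i+m-1}(u_1,\dots,u_r)+d^me_{i+m}(u_1,\dots,u_r)\big){i+m-1\brack m-1}_q$. ${m\brack s}_q=\prod_{t=0}^{s-1}\frac{1-q^{m-t}}{1-q^{t+1}}$ for $0\le s\le m$, and $0$ otherwise. $e_n(u_1,\dots,u_s)$ is the $n$-th elementary symmetric polynomial in $u_1,\dots,u_s$, with $e_0=1$ and $e_n=0$ for $n<0$ or $n>s$. $u_1,\dots,u_r,d,q$ are parameters. -}

module Defs where

open import Level using (Level)
open import Algebra.Bundles using (CommutativeRing)
open import Data.Nat using (ℕ; zero; suc; _∸_; _≤?_)
open import Relation.Nullary using (yes; no)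

module _ {c ℓ : Level} (R : CommutativeRing c ℓ) where
  open CommutativeRing R

  pow : Carrier → ℕ → Carrier
  pow x zero    = 1#
  pow x (suc n) = x * pow x n

  sgn : ℕ → Carrier
  sgn n = pow (- 1#) n

  sumBelow : ℕ → (ℕ → Carrier) → Carrier
  sumBelow zero    f = 0#
  sumBelow (suc n) f = sumBelow n f + f n

  sum1to : ℕ → (ℕ → Carrier) → Carrier
  sum1to n f = sumBelow n (λ j → f (suc j))

  sum0to : ℕ → (ℕ → Carrier) → Carrier
  sum0to n f = sumBelow (suc n) f

  -- esym u s n = e_n(u_1,…,u_s), the n-th elementary symmetric polynomial
  -- (e_0 = 1, e_n = 0 for n > s), via the standard recursion
  -- e_n(u_1..u_{s+1}) = e_n(u_1..u_s) + u_{s+1} e_{n-1}(u_1..u_s).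
  esym : (ℕ → Carrier) → ℕ → ℕ → Carrier
  esym u zero    zero    = 1#
  esym u zero    (suc n) = 0#
  esym u (suc s) zero    = 1#
  esym u (suc s) (suc n) = esym u s (suc n) + u (suc s) * esym u s n

  -- Gaussian binomial [m brack s]_q, as a polynomial in q via q-Pascal:
  -- [m,0]=1, [0,s+1]=0, [m+1,s+1] = [m,s] + q^{s+1} [m,s+1].
  qbinom : Carrier → ℕ → ℕ → Carrier
  qbinom q m       zero    = 1#
  qbinom q zero    (suc s) = 0#
  qbinom q (suc m) (suc s) = qbinom q m s + pow q (suc s) * qbinom q m (suc s)

  -- c_{k,i} = d^k u_r^k q^{k(k+1)/2} [i-1 brack k]_q
  -- (q^{k(k+1)/2} written as q^{0+1+...+k})
  triPow : Carrier → ℕ → Carrier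
  triPow q zero    = 1#
  triPow q (suc k) = pow q (suc k) * triPow q k

  cc : (u : ℕ → Carrier) (r : ℕ) (d q : Carrier) → ℕ → ℕ → Carrier
  cc u r d q k i = pow d k * pow (u r) k * triPow q k * qbinom q (i ∸ 1) k

  -- b_{m,i} = (d^{m-1} e_{i+m-1}(u_1..u_r) + d^m e_{i+m}(u_1..u_r)) [i+m-1 brack m-1]_q
  -- (only used for m ≥ 1)
  bb : (u : ℕ → Carrier) (r : ℕ) (d q : Carrier) → ℕ → ℕ → Carrier
  bb u r d q m i =
    (pow d (m ∸ 1) * esym u r (i Data.Nat.+ m ∸ 1) + pow d m * esym u r (i Data.Nat.+ m))
      * qbinom q (i Data.Nat.+ m ∸ 1) (m ∸ 1)

  -- Formal power series are coefficient sequences ℕ → Carrier.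
  -- xpow m G = x^m G(x):  coefficient n is G_{n-m} if m ≤ n, else 0
  -- (equivalently G_{n-m} with the convention G_j = 0 for j < 0).
  xpow : ℕ → (ℕ → Carrier) → ℕ → Carrier
  xpow m G n with m ≤? n
  ... | yes _ = G (n ∸ m)
  ... | no  _ = 0#

  -- dil s G = G(x s): coefficient n is s^n G_n
  dil : Carrier → (ℕ → Carrier) → ℕ → Carrier
  dil s G n = pow s n * G n

-- Comparing coefficients of x^n, the functional equation reads A_n + S_n = q^n A_n + T_n, where S_n and
-- T_n are the coefficients of (Σᵢ (-x)^i αᵢ) F(x) and of the triple sum; that is, (1 - q^n) A_n = T_n - S_n.
-- Since x^ℓ F(x q^i) has coefficient q^{i(n-ℓ)} A_{n-ℓ} at x^n, interchanging the sums over i and ℓ turns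
-- T_n into the q-weighted part of the recurrence, and (-1)^{m+1} = -(-1)^m turns S_n into the rest.
-- For n = 0 both S_0 and T_0 vanish, so the constant coefficient carries no condition. Nothing depends on
-- the particular α, c, b, nor on r ≥ 1.
module Submission where

open import Defs
open import Level using (Level)
open import Algebra.Bundles using (CommutativeRing)
open import Data.Nat using (ℕ; _≤_; _∸_; _⊓_; zero; suc; _≤?_; s≤s; z≤n)
open import Data.Product using (_×_; map₂)
open import Function.Bundles using (_⇔_; mk⇔; Equivalence)
open import Data.Maybe using (nothing)
open import Relation.Nullary using (yes; no)
open import Relation.Binary.PropositionalEquality using (_≡_; cong)
import Relation.Binary.PropositionalEquality as ≡
import Data.Nat.Properties as ℕ
open import Tactic.RingSolver.Core.AlmostCommutativeRing using (fromCommutativeRing)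
import Algebra.Properties.AbelianGroup as AbelianGroupProperties
import Algebra.Properties.Group as GroupProperties
import Algebra.Properties.Quasigroup as QuasigroupProperties
import Algebra.Properties.Ring as RingProperties
import Algebra.Properties.Semiring.Exp as SemiringExp
import Relation.Binary.Reasoning.Setoid as SetoidReasoning
import Tactic.RingSolver.NonReflective as RingSolver

module Properties {c ℓ : Level} (R : CommutativeRing c ℓ) where
  open CommutativeRing R
  open AbelianGroupProperties +-abelianGroup using (⁻¹-∙-comm; ⁻¹-involutive; xyx⁻¹≈y)
  open QuasigroupProperties (GroupProperties.quasigroup +-group) using (x≈z//y)
  open RingProperties ring using (-1*x≈-x; -‿distribˡ-*; -‿distribʳ-*)
  open SemiringExp semiring using (_^_; ^-assocʳ)
  open RingSolver (fromCommutativeRing R (λ _ → nothing)) using (solve; _⊜_; _⊕_; _⊗_; ⊝_; Κ)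
  open SetoidReasoning setoid

  sumBelow-cong : ∀ n {f g : ℕ → Carrier} → (∀ j → f j ≈ g j) → sumBelow R n f ≈ sumBelow R n g
  sumBelow-cong zero    f≈g = refl
  sumBelow-cong (suc n) f≈g = +-cong (sumBelow-cong n f≈g) (f≈g n)

  sumBelow-zero : ∀ n {f : ℕ → Carrier} → (∀ j → f j ≈ 0#) → sumBelow R n f ≈ 0#
  sumBelow-zero zero    f≈0 = refl
  sumBelow-zero (suc n) f≈0 = trans (+-cong (sumBelow-zero n f≈0) (f≈0 n)) (+-identityˡ 0#)

  sumBelow-distrib-+ : ∀ n (f g : ℕ → Carrier) →
    sumBelow R n (λ j → f j + g j) ≈ sumBelow R n f + sumBelow R n g
  sumBelow-distrib-+ zero    f g = sym (+-identityˡ 0#)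
  sumBelow-distrib-+ (suc n) f g = trans (+-congʳ (sumBelow-distrib-+ n f g))
    (solve 4 (λ a b x y → ((a ⊕ b) ⊕ (x ⊕ y)) ⊜ ((a ⊕ x) ⊕ (b ⊕ y))) refl
      (sumBelow R n f) (sumBelow R n g) (f n) (g n))

  *-distribʳ-sumBelow : ∀ n (f : ℕ → Carrier) x → sumBelow R n f * x ≈ sumBelow R n (λ j → f j * x)
  *-distribʳ-sumBelow zero    f x = zeroˡ x
  *-distribʳ-sumBelow (suc n) f x =
    trans (distribʳ x (sumBelow R n f) (f n)) (+-congʳ (*-distribʳ-sumBelow n f x))

  -‿distrib-sumBelow : ∀ n (f : ℕ → Carrier) → - sumBelow R n f ≈ sumBelow R n (λ j → - f j)
  -‿distrib-sumBelow zero    f = trans (sym (+-identityˡ (- 0#))) (-‿inverseʳ 0#)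
  -‿distrib-sumBelow (suc n) f =
    trans (sym (⁻¹-∙-comm (sumBelow R n f) (f n))) (+-congʳ (-‿distrib-sumBelow n f))

  sumBelow-comm : ∀ m n (f : ℕ → ℕ → Carrier) →
    sumBelow R m (λ i → sumBelow R n (f i)) ≈ sumBelow R n (λ j → sumBelow R m (λ i → f i j))
  sumBelow-comm zero    n f = sym (sumBelow-zero n (λ _ → refl))
  sumBelow-comm (suc m) n f = trans (+-congʳ (sumBelow-comm m n f))
    (sym (sumBelow-distrib-+ n (λ j → sumBelow R m (λ i → f i j)) (f m)))

  pow≡^ : ∀ x n → pow R x n ≡ x ^ n
  pow≡^ x zero    = ≡.refl
  pow≡^ x (suc n) = cong (x *_) (pow≡^ x n)

  pow-assocʳ : ∀ x m n → pow R (pow R x m) n ≈ pow R x (m Data.Nat.* n)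
  pow-assocʳ x m n = begin
    pow R (pow R x m) n  ≡⟨ pow≡^ (pow R x m) n ⟩
    pow R x m ^ n        ≡⟨ cong (_^ n) (pow≡^ x m) ⟩
    (x ^ m) ^ n          ≈⟨ ^-assocʳ x m n ⟩
    x ^ (m Data.Nat.* n) ≡⟨ pow≡^ x (m Data.Nat.* n) ⟨
    pow R x (m Data.Nat.* n) ∎

  sgn-suc : ∀ m → sgn R (suc m) ≈ - sgn R m
  sgn-suc m = -1*x≈-x (sgn R m)

  sgn-+1 : ∀ m → sgn R (m Data.Nat.+ 1) ≈ - sgn R m
  sgn-+1 m = trans (reflexive (cong (sgn R) (ℕ.+-comm m 1))) (sgn-suc m)

  sgn-+2 : ∀ m → sgn R (suc m Data.Nat.+ 1) ≈ sgn R m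
  sgn-+2 m = trans (sgn-+1 (suc m)) (trans (-‿cong (sgn-suc m)) (⁻¹-involutive (sgn R m)))

  xpow-suc-at-0 : ∀ m G → xpow R (suc m) G 0 ≡ 0#
  xpow-suc-at-0 m G with suc m ≤? 0
  ... | no _ = ≡.refl

  xpow-dil : ∀ m s G n → xpow R m (dil R s G) n ≈ pow R s (n ∸ m) * xpow R m G n
  xpow-dil m s G n with m ≤? n
  ... | yes _ = refl
  ... | no  _ = sym (zeroʳ (pow R s (n ∸ m)))

  xpow-dil-pow : ∀ q i m G n →
    pow R q (i Data.Nat.* (n ∸ m)) * xpow R m G n ≈ xpow R m (dil R (pow R q i) G) n
  xpow-dil-pow q i m G n = sym (trans (xpow-dil m (pow R q i) G n) (*-congʳ (pow-assocʳ q i (n ∸ m))))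

  -- Negated terms are passed to the solver as atoms: with no zero test on coefficients
  -- (the λ _ → nothing above) it cannot cancel y against - y.
  x+s≈y+t⇒x-y≈-s+t : ∀ x y s t → x + s ≈ y + t → x - y ≈ - s + t
  x+s≈y+t⇒x-y≈-s+t x y s t eq = begin
    x - y               ≈⟨ +-congʳ (x≈z//y x s (y + t) eq) ⟩
    (y + t) - s - y     ≈⟨ solve 4 (λ y t s⁻ y⁻ → (((y ⊕ t) ⊕ s⁻) ⊕ y⁻) ⊜ ((y ⊕ (s⁻ ⊕ t)) ⊕ y⁻))
                                 refl y t (- s) (- y) ⟩
    y + (- s + t) - y   ≈⟨ xyx⁻¹≈y y (- s + t) ⟩
    - s + t             ∎

  x-y≈-s+t⇒x+s≈y+t : ∀ x y s t → x - y ≈ - s + t → x + s ≈ y + t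
  x-y≈-s+t⇒x+s≈y+t x y s t eq = begin
    x + s                     ≈⟨ +-congʳ (x≈z//y x (- y) (- s + t) eq) ⟩
    (- s + t) - - y + s       ≈⟨ +-cong (+-congˡ (⁻¹-involutive y)) (sym (⁻¹-involutive s)) ⟩
    (- s + t) + y - - s       ≈⟨ solve 4 (λ s⁻ t y s⁻⁻ → (((s⁻ ⊕ t) ⊕ y) ⊕ s⁻⁻) ⊜ ((s⁻ ⊕ (y ⊕ t)) ⊕ s⁻⁻))
                                       refl (- s) t y (- - s) ⟩
    - s + (y + t) - - s       ≈⟨ xyx⁻¹≈y (- s) (y + t) ⟩
    y + t                     ∎

  [1-x]y≈y-xy : ∀ x y → (1# - x) * y ≈ y - x * y
  [1-x]y≈y-xy x y = trans (distribʳ y 1# (- x)) (+-cong (*-identityˡ y) (sym (-‿distribˡ-* x y)))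

  a+s≈Qa+t⇔[1-Q]a≈-s+t : ∀ Q a s t → (a + s ≈ Q * a + t) ⇔ ((1# - Q) * a ≈ - s + t)
  a+s≈Qa+t⇔[1-Q]a≈-s+t Q a s t = mk⇔
    (λ eq → trans ([1-x]y≈y-xy Q a) (x+s≈y+t⇒x-y≈-s+t a (Q * a) s t eq))
    (λ eq → x-y≈-s+t⇒x+s≈y+t a (Q * a) s t (trans (sym ([1-x]y≈y-xy Q a)) eq))

  module Coefficients (r : ℕ) (α : ℕ → Carrier) (c b : ℕ → ℕ → Carrier) (q : Carrier) (A : ℕ → Carrier) where

    -- Coefficients of x^n in Σᵢ (-x)^i α_i F(x), in the triple sum of the functional equation,
    -- and the right-hand side of the recurrence.
    leftSum : ℕ → Carrier
    leftSum n = sum1to R r (λ i → sgn R i * α i * xpow R i A n)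

    rightSum : ℕ → Carrier
    rightSum n = sum1to R r (λ i → sum1to R r (λ l → sum0to R ((i ∸ 1) ⊓ (l ∸ 1)) (λ k →
      c k i * b (l ∸ k) i * sgn R (l ∸ 1) * xpow R l (dil R (pow R q i) A) n)))

    weight : ℕ → ℕ → Carrier
    weight n m = sum1to R r (λ i → sum0to R ((i ∸ 1) ⊓ (m ∸ 1)) (λ k →
      c k i * b (m ∸ k) i * pow R q (i Data.Nat.* (n ∸ m))))

    recurrenceSum : ℕ → Carrier
    recurrenceSum n = sum1to R r (λ m → (α m + weight n m) * sgn R (m Data.Nat.+ 1) * xpow R m A n)

    leftSum-at-0 : leftSum 0 ≈ 0#
    leftSum-at-0 = sumBelow-zero r (λ j → trans (*-congˡ (reflexive (xpow-suc-at-0 j A))) (zeroʳ _))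

    rightSum-at-0 : rightSum 0 ≈ 0#
    rightSum-at-0 = sumBelow-zero r (λ i → sumBelow-zero r (λ j → sumBelow-zero (suc (i ⊓ j)) (λ k →
      trans (*-congˡ (reflexive (xpow-suc-at-0 j (dil R (pow R q (suc i)) A)))) (zeroʳ _))))

    alternating-part : ∀ n → sum1to R r (λ m → α m * sgn R (m Data.Nat.+ 1) * xpow R m A n) ≈ - leftSum n
    alternating-part n = trans (sumBelow-cong r termwise) (sym (-‿distrib-sumBelow r _))
      where
      termwise : ∀ j → α (suc j) * sgn R (suc j Data.Nat.+ 1) * xpow R (suc j) A n
                     ≈ - (sgn R (suc j) * α (suc j) * xpow R (suc j) A n)
      termwise j = begin
        a * sgn R (m Data.Nat.+ 1) * X  ≈⟨ *-congʳ (*-congˡ (sgn-+1 m)) ⟩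
        a * - sgn R m * X               ≈⟨ *-congʳ (-‿distribʳ-* a (sgn R m)) ⟨
        - (a * sgn R m) * X             ≈⟨ -‿distribˡ-* (a * sgn R m) X ⟨
        - (a * sgn R m * X)             ≈⟨ -‿cong (*-congʳ (*-comm a (sgn R m))) ⟩
        - (sgn R m * a * X)             ∎
        where
        m : ℕ
        m = suc j
        a X : Carrier
        a = α m
        X = xpow R m A n

    weighted-shift : ∀ n C i j →
      C * pow R q (i Data.Nat.* (n ∸ suc j)) * (sgn R (suc j Data.Nat.+ 1) * xpow R (suc j) A n)
      ≈ C * sgn R j * xpow R (suc j) (dil R (pow R q i) A) n
    weighted-shift n C i j = begin
      C * P * (s * X)  ≈⟨ solve 4 (λ C P s X → ((C ⊗ P) ⊗ (s ⊗ X)) ⊜ ((C ⊗ s) ⊗ (P ⊗ X))) refl C P s X ⟩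
      C * s * (P * X)  ≈⟨ *-cong (*-congˡ (sgn-+2 j)) (xpow-dil-pow q i (suc j) A n) ⟩
      C * sgn R j * xpow R (suc j) (dil R (pow R q i) A) n ∎
      where
      P s X : Carrier
      P = pow R q (i Data.Nat.* (n ∸ suc j))
      s = sgn R (suc j Data.Nat.+ 1)
      X = xpow R (suc j) A n

    weight-part : ∀ n → sum1to R r (λ m → weight n m * (sgn R (m Data.Nat.+ 1) * xpow R m A n)) ≈ rightSum n
    weight-part n =
      trans (sumBelow-cong r (λ j → trans (*-distribʳ-sumBelow r _ (y (suc j)))
                                          (sumBelow-cong r (λ i → *-distribʳ-sumBelow (suc (i ⊓ j)) _ (y (suc j))))))
      (trans (sumBelow-comm r r _)
      (sumBelow-cong r (λ i → sumBelow-cong r (λ j → sumBelow-cong (suc (i ⊓ j)) (λ k →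
        weighted-shift n (c k (suc i) * b (suc j ∸ k) (suc i)) (suc i) j)))))
      where
      y : ℕ → Carrier
      y m = sgn R (m Data.Nat.+ 1) * xpow R m A n

    recurrenceSum≈-leftSum+rightSum : ∀ n → recurrenceSum n ≈ - leftSum n + rightSum n
    recurrenceSum≈-leftSum+rightSum n =
      trans (sumBelow-cong r (λ j →
        split (α (suc j)) (weight n (suc j)) (sgn R (suc j Data.Nat.+ 1)) (xpow R (suc j) A n)))
      (trans (sumBelow-distrib-+ r _ _) (+-cong (alternating-part n) (weight-part n)))
      where
      split : ∀ a w s X → (a + w) * s * X ≈ a * s * X + w * (s * X)
      split a w s X =
        trans (*-congʳ (distribʳ s a w)) (trans (distribʳ X (a * s) (w * s)) (+-congˡ (*-assoc w s X)))

    functionalEquation⇔recurrence :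
      (A 0 ≈ 1# × (∀ n → A n + leftSum n ≈ dil R q A n + rightSum n))
      ⇔ (A 0 ≈ 1# × (∀ n → 1 ≤ n → (1# - pow R q n) * A n ≈ recurrenceSum n))
    functionalEquation⇔recurrence = mk⇔ (map₂ toRecurrence) (map₂ toFunctionalEquation)
      where
      coefficient⇔ : ∀ n → (A n + leftSum n ≈ pow R q n * A n + rightSum n)
                         ⇔ ((1# - pow R q n) * A n ≈ recurrenceSum n)
      coefficient⇔ n = mk⇔
        (λ eq → trans (Equivalence.to rearranged eq) (sym (recurrenceSum≈-leftSum+rightSum n)))
        (λ eq → Equivalence.from rearranged (trans eq (recurrenceSum≈-leftSum+rightSum n)))
        where
        rearranged : (A n + leftSum n ≈ pow R q n * A n + rightSum n)
                   ⇔ ((1# - pow R q n) * A n ≈ - leftSum n + rightSum n)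
        rearranged = a+s≈Qa+t⇔[1-Q]a≈-s+t (pow R q n) (A n) (leftSum n) (rightSum n)

      toRecurrence : (∀ n → A n + leftSum n ≈ dil R q A n + rightSum n) →
                     ∀ n → 1 ≤ n → (1# - pow R q n) * A n ≈ recurrenceSum n
      toRecurrence fe n _ = Equivalence.to (coefficient⇔ n) (fe n)

      toFunctionalEquation : (∀ n → 1 ≤ n → (1# - pow R q n) * A n ≈ recurrenceSum n) →
                             ∀ n → A n + leftSum n ≈ dil R q A n + rightSum n
      toFunctionalEquation _   zero    =
        trans (+-cong (sym (*-identityˡ (A 0))) leftSum-at-0) (+-congˡ (sym rightSum-at-0))
      toFunctionalEquation rec (suc n) = Equivalence.from (coefficient⇔ (suc n)) (rec (suc n) (s≤s z≤n))

lemma3p7 : ∀ {c ℓ : Level} (R : CommutativeRing c ℓ) →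
  let open CommutativeRing R in
  (r : ℕ) → 1 ≤ r → (u : ℕ → Carrier) (d q : Carrier) (A : ℕ → Carrier) →
  let α : ℕ → Carrier
      α i = pow R d (i ∸ 1) * esym R u (r ∸ 1) (i ∸ 1) + pow R d i * esym R u (r ∸ 1) i
      c : ℕ → ℕ → Carrier
      c = cc R u r d q
      b : ℕ → ℕ → Carrier
      b = bb R u r d q
  in
  (A 0 ≈ 1#
    × (∀ n →
        A n + sum1to R r (λ i → sgn R i * α i * xpow R i A n)
        ≈ dil R q A n
          + sum1to R r (λ i → sum1to R r (λ l → sum0to R ((i ∸ 1) ⊓ (l ∸ 1)) (λ k →
              c k i * b (l ∸ k) i * sgn R (l ∸ 1) * xpow R l (dil R (pow R q i) A) n)))))
  ⇔
  (A 0 ≈ 1#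
    × (∀ n → 1 ≤ n →
        (1# - pow R q n) * A n
        ≈ sum1to R r (λ m →
            (α m + sum1to R r (λ i → sum0to R ((i ∸ 1) ⊓ (m ∸ 1)) (λ k →
                c k i * b (m ∸ k) i * pow R q (i Data.Nat.* (n ∸ m)))))
            * sgn R (m Data.Nat.+ 1) * xpow R m A n)))
lemma3p7 R r _ u d q A =
  Properties.Coefficients.functionalEquation⇔recurrence R r α (cc R u r d q) (bb R u r d q) q A
  where
  open CommutativeRing R
  α : ℕ → Carrier
  α i = pow R d (i ∸ 1) * esym R u (r ∸ 1) (i ∸ 1) + pow R d i * esym R u (r ∸ 1) i
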